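{- Let $s\ge1$ be an integer, let $G=G(s)$ be the directed capacitated graph described in the context, let $\alpha'=(\alpha'_p)_{p\in\mathbf{P}}$ be a fixed reference assignment, and let $f$ be a maximum (integer-valued) flow in $G$. Then the weighted residual graph $G_f$ contains a directed cycle of negative total weight if and only if there exists a maximum (integer-valued) flow $f^*$ in $G$ such that $d(f^*,\alpha')<d(f,\alpha')$.
   Context: Setting: $\mathbf{P}=\{1,\dots,P\}$ partitions, $\mathbf{N}$ nodes, $\mathbf{Z}$ zones; node $n$ has capacity $c_n\in\mathbb{Z}_{\ge0}$ and zone $z_n$; integers $1\le\rho_\mathbf{Z}\le\rho_\mathbf{N}$. The graph $G(s)$ has vertices: source $\mathbf{s}$, sink $\mathbf{t}$, $\mathbf{p}^+,\mathbf{p}^-$ for each partition $p$, $\mathbf{x}_{p,z}$ for each partition $p$ and zone $z$, $\mathbf{n}$ for each node $n$. Arcs with capacities: $(\mathbf{s},\mathbf{p}^+)$ cap. $\rho_\mathbf{Z}$; $(\mathbf{s},\mathbf{p}^-)$ cap. $\rho_\mathbf{N}-\rho_\mathbf{Z}$; $(\mathbf{p}^+,\mathbf{x}_{p,z})$ cap. $1$; $(\mathbf{p}^-,\mathbf{x}_{p,z})$ cap. $\rho_\mathbf{N}-\rho_\mathbf{Z}$; $(\mathbf{x}_{p,z},\mathbf{n})$ cap. $1$ whenever $z_n=z$; $(\mathbf{n},\mathbf{t})$ cap. $\lfloor c_n/s\rfloor$. Flows are integer-valued, respect capacities and conservation at inner vertices; a maximum flow has maximum value among all flows. A reference assignment is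 a choice of subset $\alpha'_p\subseteq\mathbf{N}$ for each $p$. Let $X$ be the set of arcs $(\mathbf{x}_{p,z_n},\mathbf{n})$; such an arc is "used by $\alpha'$" if $n\in\alpha'_p$. For a flow $f$, $d(f,\alpha')=\#\{e=(\mathbf{x}_{p,z_n},\mathbf{n})\in X : f(e)=1 \text{ xor } n\in\alpha'_p\}$. Residual graph $G_f$: same vertices; forward arc $u\to v$ for each arc $(u,v)$ of $G$ with $f(u,v)<c(u,v)$, reverse arc $v\to u$ for each arc $(u,v)$ of $G$ with $f(u,v)>0$. An arc of $G_f$ arising from $e\in X$ (in either direction) has weight $-1$ if $f(e)=1$ xor $e$ is used by $\alpha'$, and $+1$ otherwise; all other arcs of $G_f$ have weight $0$. The weight of a cycle is the sum of the weights of its arcs. -}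

module Defs where

open import Data.Nat using (ℕ; zero; suc; _+_; _<_; _≤_; NonZero; _≡ᵇ_)
open import Data.Nat.DivMod using (_/_)
open import Data.Fin using (Fin; _≟_)
open import Data.Bool using (Bool; true; false; if_then_else_; _xor_)
open import Data.Integer as ℤ using (ℤ; 0ℤ; 1ℤ; -1ℤ)
open import Data.List using (List; []; _∷_; map)
open import Data.List.Relation.Unary.All using (All)
open import Data.List.Relation.Unary.Unique.Propositional using (Unique)
open import Data.Product using (Σ; _×_; _,_)
open import Data.Unit using (⊤)
open import Data.Empty using (⊥)
open import Relation.Nullary.Decidable using (⌊_⌋)
open import Relation.Binary.PropositionalEquality using (_≡_)

ΣFin : (n : ℕ) → (Fin n → ℕ) → ℕ
ΣFin zero    g = 0
ΣFin (suc n) g = g Fin.zero + ΣFin n (λ i → g (Fin.suc i))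

-- The network G(s).  Partitions = Fin P, nodes = Fin N, zones = Fin Z,
-- zone n = z_n, cap n = c_n.
module Network (P N Z : ℕ) (zone : Fin N → Fin Z) (cap : Fin N → ℕ)
               (ρZ ρN s : ℕ) .{{_ : NonZero s}} where

  data Vertex : Set where
    src snk : Vertex
    pplus pminus : Fin P → Vertex
    x : Fin P → Fin Z → Vertex
    node : Fin N → Vertex

  data Arc : Set where
    s→p+ s→p- : Fin P → Arc
    p+→x p-→x : Fin P → Fin Z → Arc
    xn : Fin P → Fin N → Arc
    n→t : Fin N → Arc

  tail head : Arc → Vertex
  tail (s→p+ p)   = src
  tail (s→p- p)   = src
  tail (p+→x p z) = pplus p
  tail (p-→x p z) = pminus p
  tail (xn p n)   = x p (zone n)
  tail (n→t n)    = node n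
  head (s→p+ p)   = pplus p
  head (s→p- p)   = pminus p
  head (p+→x p z) = x p z
  head (p-→x p z) = x p z
  head (xn p n)   = node n
  head (n→t n)    = snk

  capacity : Arc → ℕ
  capacity (s→p+ p)   = ρZ
  capacity (s→p- p)   = ρN Data.Nat.∸ ρZ
  capacity (p+→x p z) = 1
  capacity (p-→x p z) = ρN Data.Nat.∸ ρZ
  capacity (xn p n)   = 1
  capacity (n→t n)    = cap n / s

  Conserved : (Arc → ℕ) → Vertex → Set
  Conserved f src        = ⊤
  Conserved f snk        = ⊤
  Conserved f (pplus p)  = f (s→p+ p) ≡ ΣFin Z (λ z → f (p+→x p z))
  Conserved f (pminus p) = f (s→p- p) ≡ ΣFin Z (λ z → f (p-→x p z))
  Conserved f (x p z)    = f (p+→x p z) + f (p-→x p z)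
                           ≡ ΣFin N (λ n → if ⌊ zone n ≟ z ⌋ then f (xn p n) else 0)
  Conserved f (node n)   = ΣFin P (λ p → f (xn p n)) ≡ f (n→t n)

  record Flow : Set where
    field
      flow      : Arc → ℕ
      bounded   : ∀ e → flow e ≤ capacity e
      conserved : ∀ v → Conserved flow v
  open Flow public

  value : Flow → ℕ
  value f = ΣFin P (λ p → flow f (s→p+ p) + flow f (s→p- p))

  IsMaxFlow : Flow → Set
  IsMaxFlow f = ∀ (g : Flow) → value g ≤ value f

  -- Reference assignment: α' p n = true iff n ∈ α'_p.
  Assignment : Set
  Assignment = Fin P → Fin N → Bool

  one? : ℕ → Bool
  one? k = k ≡ᵇ 1

  dist : Flow → Assignment → ℕ
  dist f α = ΣFin P (λ p → ΣFin N (λ n →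
               if one? (flow f (xn p n)) xor α p n then 1 else 0))

  data Dir : Set where
    fwd bwd : Dir

  RArc : Set
  RArc = Arc × Dir

  rtail rhead : RArc → Vertex
  rtail (e , fwd) = tail e
  rtail (e , bwd) = head e
  rhead (e , fwd) = head e
  rhead (e , bwd) = tail e

  InResidual : Flow → RArc → Set
  InResidual f (e , fwd) = flow f e < capacity e
  InResidual f (e , bwd) = 0 < flow f e

  weight : Flow → Assignment → RArc → ℤ
  weight f α (xn p n , _) = if one? (flow f (xn p n)) xor α p n then -1ℤ else 1ℤ
  weight f α _            = 0ℤ

  totalWeight : Flow → Assignment → List RArc → ℤ
  totalWeight f α []       = 0ℤ
  totalWeight f α (a ∷ as) = weight f α a ℤ.+ totalWeight f α as

  Linked : List RArc → Set
  Linked []           = ⊤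
  Linked (a ∷ [])     = ⊤
  Linked (a ∷ b ∷ as) = rhead a ≡ rtail b × Linked (b ∷ as)

  lastOf : RArc → List RArc → RArc
  lastOf a []       = a
  lastOf a (b ∷ as) = lastOf b as

  IsCycle : Flow → List RArc → Set
  IsCycle f []       = ⊥
  IsCycle f (a ∷ as) = All (InResidual f) (a ∷ as)
                     × Linked (a ∷ as)
                     × rhead (lastOf a as) ≡ rtail a
                     × Unique (map rtail (a ∷ as))

  HasNegativeCycle : Flow → Assignment → Set
  HasNegativeCycle f α = Σ (List RArc) λ c → IsCycle f c × totalWeight f α c ℤ.< 0ℤ

module Submission where

-- The weight of a residual arc is the change of d(·, α') caused by pushing one unit of flow
-- through it: only the arcs (x_{p,z_n}, n) carry weight, they have capacity 1, and on them a flow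
-- is 0 or 1. Pushing one unit around a cycle of G_f keeps conservation and the value, and changes
-- d by the weight of the cycle; so a negative cycle yields a maximum flow closer to α'.
-- Conversely let f* be a maximum flow with d(f*, α') < d(f, α'). As f and f* have the same value,
-- f* − f has excess 0 everywhere, so its support (arcs with f < f* used forwards, arcs with
-- f* < f used backwards) contains a simple cycle C, which is a cycle of G_f. If C is not negative,
-- pushing C backwards through f* gives a maximum flow that is no farther from α' and strictly
-- closer to f in ℓ¹; by induction on ∑ₑ |f*(e) − f(e)| a negative cycle is found eventually.

open import Defs
import Algebra.Properties.CommutativeSemigroup as CommSemigroup
open import Data.Bool using (Bool; true; false; if_then_else_; _∧_; not; _xor_)
open import Data.Fin using (Fin; zero; suc)
import Data.Fin.Properties as Fin
import Data.Integer as ℤ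
import Data.Integer.Properties as ℤP
open import Data.List using (List; []; _∷_; map; _++_; length; allFin; cartesianProduct)
open import Data.List.Properties using (length-removeAt′; length-map)
open import Data.List.Membership.Propositional using (_∈_; _─_)
open import Data.List.Membership.Propositional.Properties
  using (∈-map⁺; ∈-++⁺ˡ; ∈-++⁺ʳ; ∈-allFin; ∈-cartesianProduct⁺)
open import Data.List.Relation.Binary.Sublist.Propositional using (_⊆_; []; _∷_; minimum)
open import Data.List.Relation.Binary.Sublist.Propositional.Properties using (All-resp-⊆)
open import Data.List.Relation.Unary.All as All using (All; []; _∷_)
import Data.List.Relation.Unary.All.Properties as AllP
open import Data.List.Relation.Unary.AllPairs using ([]; _∷_)
open import Data.List.Relation.Unary.Any using (here; there; index)
open import Data.List.Relation.Unary.Unique.Propositional using (Unique)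
open import Data.Nat
  using (ℕ; zero; suc; _+_; _*_; _∸_; _≤_; _<_; z≤n; s≤s; _<?_; _≡ᵇ_; NonZero; ∣_-_∣)
open import Data.Nat.Induction using (<-wellFounded)
open import Data.Nat.Properties
import Data.Product as Product
open import Data.Product using (Σ; ∃; _×_; _,_; proj₁; proj₂; uncurry)
open import Data.Product.Properties using (,-injective)
open import Data.Sum using (_⊎_; inj₁; inj₂; [_,_]′)
import Data.Sum.Properties as Sum
open import Data.Unit using (tt)
open import Function using (_∘_; id; _on_; _⇔_; mk⇔; Equivalence)
open import Induction.WellFounded using (Acc; acc)
open import Relation.Binary.Construct.On as On using ()
open import Relation.Binary.Definitions using (DecidableEquality; tri<; tri≈; tri>)
open import Relation.Binary.PropositionalEquality
open import Relation.Nullary using (¬_; Dec; yes; no; does; contradiction)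
open import Relation.Nullary.Decidable
  using (map′; _×-dec_; ⌊_⌋; isYes; isYes≗does; dec-true; dec-false)

open CommSemigroup +-commutativeSemigroup using (interchange)
open CommSemigroup ℤP.+-commutativeSemigroup using () renaming (interchange to ℤ-interchange)

[_]·_ : Bool → ℕ → ℕ
[ b ]· k = if b then k else 0

⟦_⟧ : Bool → ℕ
⟦ b ⟧ = [ b ]· 1

⟦⟧≤1 : ∀ b → ⟦ b ⟧ ≤ 1
⟦⟧≤1 true  = ≤-refl
⟦⟧≤1 false = z≤n

[]·-+ : ∀ b m n → [ b ]· (m + n) ≡ [ b ]· m + [ b ]· n
[]·-+ true  m n = refl
[]·-+ false m n = refl

⟦⟧-* : ∀ b k → ⟦ b ⟧ * k ≡ [ b ]· k
⟦⟧-* true  k = +-identityʳ k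
⟦⟧-* false k = refl

*-⟦⟧ : ∀ k b → k * ⟦ b ⟧ ≡ [ b ]· k
*-⟦⟧ k b = trans (*-comm k ⟦ b ⟧) (⟦⟧-* b k)

[]·-positive : ∀ {A : Set} (d : Dec A) {k} → 0 < [ does d ]· k → A × 0 < k
[]·-positive (yes a) pos = a , pos
[]·-positive (no _)  ()

+-<⇒<⊎< : ∀ {a b c d} → a + b < c + d → a < c ⊎ b < d
+-<⇒<⊎< {a} {b} {c} {d} lt with a <? c
... | yes a<c = inj₁ a<c
... | no  a≮c = inj₂ (+-cancelˡ-< c b d (≤-<-trans (+-monoˡ-≤ b (≮⇒≥ a≮c)) lt))

cross-sum : ∀ {a b c d} → a ≡ c → b ≡ d → a + d ≡ b + c
cross-sum {b = b} {c = c} refl refl = +-comm c b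

cross-cancel : ∀ {a b c d} → a + d ≡ b + c → a ≡ c → b ≡ d
cross-cancel {b = b} {c} {d} eq refl = sym (+-cancelˡ-≡ c d b (trans eq (+-comm b c)))

balance-transfer : ∀ a b c d x y x′ y′ → a + x ≡ b + y → c + x′ ≡ d + y′ →
                   (a + d ≡ b + c) ⇔ (x + y′ ≡ y + x′)
balance-transfer a b c d x y x′ y′ in-eq out-eq =
  mk⇔ (λ eq → +-cancelˡ-≡ (b + c) _ _ (trans (cong (_+ (x + y′)) (sym eq)) total))
      (λ eq → +-cancelʳ-≡ (y + x′) _ _ (trans (cong ((a + d) +_) (sym eq)) total))
  where
  total : (a + d) + (x + y′) ≡ (b + c) + (y + x′)
  total = begin
    (a + d) + (x + y′) ≡⟨ interchange a d x y′ ⟩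
    (a + x) + (d + y′) ≡⟨ cong₂ _+_ in-eq (sym out-eq) ⟩
    (b + y) + (c + x′) ≡⟨ interchange b y c x′ ⟩
    (b + c) + (y + x′) ∎
    where open ≡-Reasoning

+≡+⇒< : ∀ {a b m n} → a + m ≡ b + n → n < m → a < b
+≡+⇒< {a} {b} {m} {n} eq n<m = +-cancelʳ-< m a b (subst (_< b + m) (sym eq) (+-monoʳ-< b n<m))

+≡+⇒≤ : ∀ {a b m n} → a + m ≡ b + n → m ≤ n → b ≤ a
+≡+⇒≤ {a} {b} {m} {n} eq m≤n = +-cancelʳ-≤ m b a (≤-trans (+-monoʳ-≤ b m≤n) (≤-reflexive (sym eq)))

m+[n∸m]≡n+[m∸n] : ∀ m n → m + (n ∸ m) ≡ n + (m ∸ n)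
m+[n∸m]≡n+[m∸n] m n with ≤-total m n
... | inj₁ m≤n = trans (m+[n∸m]≡n m≤n) (sym (trans (cong (n +_) (m≤n⇒m∸n≡0 m≤n)) (+-identityʳ n)))
... | inj₂ n≤m = trans (trans (cong (m +_) (m≤n⇒m∸n≡0 n≤m)) (+-identityʳ m)) (sym (m+[n∸m]≡n n≤m))

0<∸⇒< : ∀ m n → 0 < n ∸ m → m < n
0<∸⇒< m n pos with m <? n
... | yes m<n = m<n
... | no  m≮n = contradiction (subst (0 <_) (m≤n⇒m∸n≡0 (≮⇒≥ m≮n)) pos) λ ()

≤1⇒≤ : ∀ {k m} → k ≤ 1 → (0 < k → 0 < m) → k ≤ m
≤1⇒≤ z≤n       _   = z≤n
≤1⇒≤ (s≤s z≤n) pos = pos (s≤s z≤n)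

+≤1⇒≤ : ∀ {k m n} → k ≤ 1 → (0 < k → m < n) → m ≤ n → m + k ≤ n
+≤1⇒≤ {m = m} {n} z≤n       _  m≤n = subst (_≤ n) (sym (+-identityʳ m)) m≤n
+≤1⇒≤ {m = m} {n} (s≤s z≤n) lt _   = subst (_≤ n) (+-comm 1 m) (lt (s≤s z≤n))

∣m-n∣+1≡∣1+m-n∣ : ∀ {m n} → n ≤ m → ∣ m - n ∣ + 1 ≡ ∣ suc m - n ∣
∣m-n∣+1≡∣1+m-n∣ {m}     {zero}  _         = trans (cong (_+ 1) (∣-∣-identityʳ m)) (+-comm m 1)
∣m-n∣+1≡∣1+m-n∣ {suc m} {suc n} (s≤s n≤m) = ∣m-n∣+1≡∣1+m-n∣ n≤m

∣1+m-n∣+1≡∣m-n∣ : ∀ {m n} → m < n → ∣ suc m - n ∣ + 1 ≡ ∣ m - n ∣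
∣1+m-n∣+1≡∣m-n∣ {zero}  {suc n} _         = +-comm n 1
∣1+m-n∣+1≡∣m-n∣ {suc m} {suc n} (s≤s m<n) = ∣1+m-n∣+1≡∣m-n∣ m<n

-- Finite sums over finite types

data Shape : Set where
  fin     : ℕ → Shape
  _⊕_ _⊗_ : Shape → Shape → Shape

infixr 5 _⊕_
infixr 6 _⊗_

El : Shape → Set
El (fin n) = Fin n
El (s ⊕ t) = El s ⊎ El t
El (s ⊗ t) = El s × El t

Σ⟨_⟩ : (s : Shape) → (El s → ℕ) → ℕ
Σ⟨ fin n ⟩ g = ΣFin n g
Σ⟨ s ⊕ t ⟩ g = Σ⟨ s ⟩ (g ∘ inj₁) + Σ⟨ t ⟩ (g ∘ inj₂)
Σ⟨ s ⊗ t ⟩ g = Σ⟨ s ⟩ (λ a → Σ⟨ t ⟩ (λ b → g (a , b)))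

≟-El : (s : Shape) → DecidableEquality (El s)
≟-El (fin n)                 = Fin._≟_
≟-El (s ⊕ t)                 = Sum.≡-dec (≟-El s) (≟-El t)
≟-El (s ⊗ t) (a , b) (c , d) = map′ (uncurry (cong₂ _,_)) ,-injective (≟-El s a c ×-dec ≟-El t b d)

≟-via : ∀ {A : Set} s (encode : A → El s) (decode : El s → A) → (∀ a → decode (encode a) ≡ a) →
        DecidableEquality A
≟-via s encode decode decode-encode a b =
  map′ (λ eq → trans (sym (decode-encode a)) (trans (cong decode eq) (decode-encode b)))
       (cong encode) (≟-El s (encode a) (encode b))

does-sym : ∀ {A : Set} (_≟_ : DecidableEquality A) a b → does (a ≟ b) ≡ does (b ≟ a)
does-sym _≟_ a b with a ≟ b | b ≟ a
... | yes _   | yes _   = refl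
... | no  _   | no  _   = refl
... | yes a≡b | no  b≢a = contradiction (sym a≡b) b≢a
... | no  a≢b | yes b≡a = contradiction (sym b≡a) a≢b

elements : (s : Shape) → List (El s)
elements (fin n) = allFin n
elements (s ⊕ t) = map inj₁ (elements s) ++ map inj₂ (elements t)
elements (s ⊗ t) = cartesianProduct (elements s) (elements t)

∈-elements : ∀ s (c : El s) → c ∈ elements s
∈-elements (fin n) i        = ∈-allFin i
∈-elements (s ⊕ t) (inj₁ a) = ∈-++⁺ˡ (∈-map⁺ inj₁ (∈-elements s a))
∈-elements (s ⊕ t) (inj₂ b) = ∈-++⁺ʳ (map inj₁ (elements s)) (∈-map⁺ inj₂ (∈-elements t b))
∈-elements (s ⊗ t) (a , b)  = ∈-cartesianProduct⁺ (∈-elements s a) (∈-elements t b)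

Σ-cong : ∀ s {g h : El s → ℕ} → (∀ c → g c ≡ h c) → Σ⟨ s ⟩ g ≡ Σ⟨ s ⟩ h
Σ-cong (fin zero)    eq = refl
Σ-cong (fin (suc n)) eq = cong₂ _+_ (eq zero) (Σ-cong (fin n) (eq ∘ suc))
Σ-cong (s ⊕ t)       eq = cong₂ _+_ (Σ-cong s (eq ∘ inj₁)) (Σ-cong t (eq ∘ inj₂))
Σ-cong (s ⊗ t)       eq = Σ-cong s (λ a → Σ-cong t (λ b → eq (a , b)))

Σ-zero : ∀ s → Σ⟨ s ⟩ (λ _ → 0) ≡ 0
Σ-zero (fin zero)    = refl
Σ-zero (fin (suc n)) = Σ-zero (fin n)
Σ-zero (s ⊕ t)       = cong₂ _+_ (Σ-zero s) (Σ-zero t)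
Σ-zero (s ⊗ t)       = trans (Σ-cong s (λ _ → Σ-zero t)) (Σ-zero s)

Σ-+ : ∀ s (g h : El s → ℕ) → Σ⟨ s ⟩ (λ c → g c + h c) ≡ Σ⟨ s ⟩ g + Σ⟨ s ⟩ h
Σ-+ (fin zero)    g h = refl
Σ-+ (fin (suc n)) g h =
  trans (cong (g zero + h zero +_) (Σ-+ (fin n) (g ∘ suc) (h ∘ suc)))
        (interchange (g zero) (h zero) (Σ⟨ fin n ⟩ (g ∘ suc)) (Σ⟨ fin n ⟩ (h ∘ suc)))
Σ-+ (s ⊕ t)       g h =
  trans (cong₂ _+_ (Σ-+ s (g ∘ inj₁) (h ∘ inj₁)) (Σ-+ t (g ∘ inj₂) (h ∘ inj₂)))
        (interchange (Σ⟨ s ⟩ (g ∘ inj₁)) (Σ⟨ s ⟩ (h ∘ inj₁))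
                     (Σ⟨ t ⟩ (g ∘ inj₂)) (Σ⟨ t ⟩ (h ∘ inj₂)))
Σ-+ (s ⊗ t)       g h =
  trans (Σ-cong s (λ a → Σ-+ t (λ b → g (a , b)) (λ b → h (a , b)))) (Σ-+ s _ _)

Σ-swap : ∀ s t (g : El s → El t → ℕ) →
         Σ⟨ s ⟩ (λ a → Σ⟨ t ⟩ (g a)) ≡ Σ⟨ t ⟩ (λ b → Σ⟨ s ⟩ (λ a → g a b))
Σ-swap (fin zero)    t g = sym (Σ-zero t)
Σ-swap (fin (suc n)) t g =
  trans (cong (Σ⟨ t ⟩ (g zero) +_) (Σ-swap (fin n) t (g ∘ suc))) (sym (Σ-+ t _ _))
Σ-swap (s₁ ⊕ s₂)     t g =
  trans (cong₂ _+_ (Σ-swap s₁ t (g ∘ inj₁)) (Σ-swap s₂ t (g ∘ inj₂))) (sym (Σ-+ t _ _))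
Σ-swap (s₁ ⊗ s₂)     t g =
  trans (Σ-cong s₁ (λ a → Σ-swap s₂ t (λ b → g (a , b)))) (Σ-swap s₁ t _)

term≤Σ : ∀ s (g : El s → ℕ) c → g c ≤ Σ⟨ s ⟩ g
term≤Σ (fin (suc n)) g zero     = m≤m+n _ _
term≤Σ (fin (suc n)) g (suc i)  = ≤-trans (term≤Σ (fin n) (g ∘ suc) i) (m≤n+m _ _)
term≤Σ (s ⊕ t)       g (inj₁ a) = ≤-trans (term≤Σ s (g ∘ inj₁) a) (m≤m+n _ _)
term≤Σ (s ⊕ t)       g (inj₂ b) = ≤-trans (term≤Σ t (g ∘ inj₂) b) (m≤n+m _ _)
term≤Σ (s ⊗ t)       g (a , b)  =
  ≤-trans (term≤Σ t (λ b → g (a , b)) b) (term≤Σ s (λ a → Σ⟨ t ⟩ (λ b → g (a , b))) a)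

Σ-<⇒∃< : ∀ s (g h : El s → ℕ) → Σ⟨ s ⟩ g < Σ⟨ s ⟩ h → ∃ λ c → g c < h c
Σ-<⇒∃< (fin (suc n)) g h lt =
  [ (zero ,_) , Product.map suc id ∘ Σ-<⇒∃< (fin n) (g ∘ suc) (h ∘ suc) ]′ (+-<⇒<⊎< lt)
Σ-<⇒∃< (s ⊕ t)       g h lt =
  [ Product.map inj₁ id ∘ Σ-<⇒∃< s (g ∘ inj₁) (h ∘ inj₁)
  , Product.map inj₂ id ∘ Σ-<⇒∃< t (g ∘ inj₂) (h ∘ inj₂) ]′ (+-<⇒<⊎< lt)
Σ-<⇒∃< (s ⊗ t)       g h lt with Σ-<⇒∃< s _ _ lt
... | a , ltₐ = Product.map (a ,_) id (Σ-<⇒∃< t (λ b → g (a , b)) (λ b → h (a , b)) ltₐ)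

Σ-positive : ∀ s (g : El s → ℕ) → 0 < Σ⟨ s ⟩ g → ∃ λ c → 0 < g c
Σ-positive s g pos = Σ-<⇒∃< s (λ _ → 0) g (subst (_< Σ⟨ s ⟩ g) (sym (Σ-zero s)) pos)

Σ-[]· : ∀ s b (g : El s → ℕ) → Σ⟨ s ⟩ (λ c → [ b ]· g c) ≡ [ b ]· Σ⟨ s ⟩ g
Σ-[]· s true  g = refl
Σ-[]· s false g = Σ-zero s

Σ-[∧]· : ∀ s x (y : El s → Bool) (g : El s → ℕ) →
         Σ⟨ s ⟩ (λ c → [ x ∧ y c ]· g c) ≡ [ x ]· Σ⟨ s ⟩ (λ c → [ y c ]· g c)
Σ-[∧]· s true  y g = refl
Σ-[∧]· s false y g = Σ-zero s

Σ-select : ∀ s (g : El s → ℕ) c₀ → Σ⟨ s ⟩ (λ c → [ does (≟-El s c c₀) ]· g c) ≡ g c₀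
Σ-select (fin (suc n)) g zero     = trans (cong (g zero +_) (Σ-zero (fin n))) (+-identityʳ _)
Σ-select (fin (suc n)) g (suc j)  = Σ-select (fin n) (g ∘ suc) j
Σ-select (s ⊕ t)       g (inj₁ a) = trans (cong₂ _+_ (Σ-select s (g ∘ inj₁) a) (Σ-zero t)) (+-identityʳ _)
Σ-select (s ⊕ t)       g (inj₂ b) = cong₂ _+_ (Σ-zero s) (Σ-select t (g ∘ inj₂) b)
Σ-select (s ⊗ t)       g (a , b)  =
  trans (Σ-cong s (λ a′ → Σ-[∧]· t (does (≟-El s a′ a)) (λ b′ → does (≟-El t b′ b))
                                  (λ b′ → g (a′ , b′))))
        (trans (Σ-select s _ a) (Σ-select t (λ b′ → g (a , b′)) b))

Σ-select′ : ∀ s (g : El s → ℕ) c₀ → Σ⟨ s ⟩ (λ c → [ isYes (≟-El s c₀ c) ]· g c) ≡ g c₀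
Σ-select′ s g c₀ =
  trans (Σ-cong s (λ c → cong ([_]· g c) (trans (isYes≗does (≟-El s c₀ c)) (does-sym (≟-El s) c₀ c))))
        (Σ-select s g c₀)

ΣList : {A : Set} → List A → (A → ℕ) → ℕ
ΣList []       φ = 0
ΣList (a ∷ as) φ = φ a + ΣList as φ

∈-─ : ∀ {A : Set} {x y : A} {ys} (x∈ys : x ∈ ys) → y ∈ ys → y ≢ x → y ∈ ys ─ x∈ys
∈-─ (here refl)  (here refl)  y≢x = contradiction refl y≢x
∈-─ (here refl)  (there y∈ys) _   = y∈ys
∈-─ (there x∈ys) (here refl)  _   = here refl
∈-─ (there x∈ys) (there y∈ys) y≢x = there (∈-─ x∈ys y∈ys y≢x)

Unique⇒length≤ : ∀ {A : Set} {xs ys : List A} → Unique xs → All (_∈ ys) xs → length xs ≤ length ys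
Unique⇒length≤ []          []             = z≤n
Unique⇒length≤ {ys = ys} (x∉xs ∷ u) (x∈ys ∷ xs⊆ys) =
  subst (_ ≤_) (sym (length-removeAt′ ys (index x∈ys)))
        (s≤s (Unique⇒length≤ u
                (All.zipWith (λ (y∈ys , x≢y) → ∈-─ x∈ys y∈ys (x≢y ∘ sym)) (xs⊆ys , x∉xs))))

-- Pushing a unit through a 0/1 arc

-- The effect on a 0/1 arc of pushing a cycle that crosses it k times: its value goes from x to y,
-- and if the arc is crossed, x is the reference value r and y is the other value in {0, 1}.
data Crossing (x y r : ℕ) : ℕ → Set where
  untouched : x ≡ y → Crossing x y r 0
  flipped   : x ≡ r → y ≢ r → y ≤ 1 → r ≤ 1 → Crossing x y r 1

augment-crossing : ∀ {x F B} → x ≤ 1 → F ≤ 1 → B ≤ 1 → (0 < F → x < 1) → (0 < B → 0 < x) →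
                   Crossing x (x + F ∸ B) x (F + B)
augment-crossing {x} _ z≤n z≤n _ _                         = untouched (sym (+-identityʳ x))
augment-crossing z≤n       (s≤s z≤n) z≤n       _    _    = flipped refl (λ ()) ≤-refl z≤n
augment-crossing (s≤s z≤n) z≤n       (s≤s z≤n) _    _    = flipped refl (λ ()) z≤n ≤-refl
augment-crossing (s≤s z≤n) (s≤s z≤n) _         room _    = contradiction (room (s≤s z≤n)) λ { (s≤s ()) }
augment-crossing z≤n       _         (s≤s z≤n) _    used = contradiction (used (s≤s z≤n)) λ ()

cancel-crossing : ∀ {y r F B} → y ≤ 1 → r ≤ 1 → F ≤ 1 → B ≤ 1 →
                  (0 < F → r < y) → (0 < B → y < r) → Crossing (y + B ∸ F) y r (F + B)
cancel-crossing {y} _ _ z≤n z≤n _ _                                 = untouched (+-identityʳ y)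
cancel-crossing (s≤s z≤n) z≤n       (s≤s z≤n) z≤n       _   _   = flipped refl (λ ()) ≤-refl z≤n
cancel-crossing z≤n       (s≤s z≤n) z≤n       (s≤s z≤n) _   _   = flipped refl (λ ()) z≤n ≤-refl
cancel-crossing _         _         (s≤s z≤n) (s≤s z≤n) r<y y<r =
  contradiction (r<y (s≤s z≤n)) (<-asym (y<r (s≤s z≤n)))
cancel-crossing z≤n       _         (s≤s z≤n) z≤n       r<y _   = contradiction (r<y (s≤s z≤n)) λ ()
cancel-crossing (s≤s z≤n) (s≤s z≤n) (s≤s z≤n) z≤n       r<y _   =
  contradiction (r<y (s≤s z≤n)) λ { (s≤s ()) }
cancel-crossing _         z≤n       z≤n       (s≤s z≤n) _   y<r = contradiction (y<r (s≤s z≤n)) λ ()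
cancel-crossing (s≤s z≤n) (s≤s z≤n) z≤n       (s≤s z≤n) _   y<r =
  contradiction (y<r (s≤s z≤n)) λ { (s≤s ()) }

cancel-gap : ∀ {y r F B} → F ≤ 1 → B ≤ 1 → (0 < F → r < y) → (0 < B → y < r) →
             ∣ y + B ∸ F - r ∣ + (F + B) ≡ ∣ y - r ∣
cancel-gap {y} {r} z≤n z≤n _ _ = trans (+-identityʳ _) (cong ∣_- r ∣ (+-identityʳ y))
cancel-gap {suc y} {r} (s≤s z≤n) z≤n r<y _ =
  trans (cong (λ t → ∣ t - r ∣ + 1) (+-identityʳ y)) (∣m-n∣+1≡∣1+m-n∣ (≤-pred (r<y (s≤s z≤n))))
cancel-gap {zero} (s≤s z≤n) z≤n r<y _ = contradiction (r<y (s≤s z≤n)) λ ()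
cancel-gap {y} {r} z≤n (s≤s z≤n) _ y<r =
  trans (cong (λ t → ∣ t - r ∣ + 1) (+-comm y 1)) (∣1+m-n∣+1≡∣m-n∣ (y<r (s≤s z≤n)))
cancel-gap (s≤s z≤n) (s≤s z≤n) r<y y<r = contradiction (r<y (s≤s z≤n)) (<-asym (y<r (s≤s z≤n)))

crossing-mismatch : ∀ a {x y r k} → Crossing x y r k →
                    ⟦ (y ≡ᵇ 1) xor a ⟧ + k * ⟦ (r ≡ᵇ 1) xor a ⟧
                    ≡ ⟦ (x ≡ᵇ 1) xor a ⟧ + k * ⟦ not ((r ≡ᵇ 1) xor a) ⟧
crossing-mismatch a     (untouched refl)                        = refl
crossing-mismatch a     (flipped refl y≢r z≤n       z≤n)        = contradiction refl y≢r
crossing-mismatch a     (flipped refl y≢r (s≤s z≤n) (s≤s z≤n))  = contradiction refl y≢r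
crossing-mismatch true  (flipped refl _   z≤n       (s≤s z≤n))  = refl
crossing-mismatch false (flipped refl _   z≤n       (s≤s z≤n))  = refl
crossing-mismatch true  (flipped refl _   (s≤s z≤n) z≤n)        = refl
crossing-mismatch false (flipped refl _   (s≤s z≤n) z≤n)        = refl

module Residual (P N Z : ℕ) (zone : Fin N → Fin Z) (cap : Fin N → ℕ)
                (ρZ ρN s : ℕ) .{{_ : NonZero s}} where
  open Network P N Z zone cap ρZ ρN s

  VertexShape ArcShape : Shape
  VertexShape = fin 1 ⊕ fin 1 ⊕ fin P ⊕ fin P ⊕ fin P ⊗ fin Z ⊕ fin N
  ArcShape    = fin P ⊕ fin P ⊕ fin P ⊗ fin Z ⊕ fin P ⊗ fin Z ⊕ fin P ⊗ fin N ⊕ fin N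

  encodeV : Vertex → El VertexShape
  encodeV src        = inj₁ zero
  encodeV snk        = inj₂ (inj₁ zero)
  encodeV (pplus p)  = inj₂ (inj₂ (inj₁ p))
  encodeV (pminus p) = inj₂ (inj₂ (inj₂ (inj₁ p)))
  encodeV (x p z)    = inj₂ (inj₂ (inj₂ (inj₂ (inj₁ (p , z)))))
  encodeV (node n)   = inj₂ (inj₂ (inj₂ (inj₂ (inj₂ n))))

  decodeV : El VertexShape → Vertex
  decodeV (inj₁ _)                                   = src
  decodeV (inj₂ (inj₁ _))                            = snk
  decodeV (inj₂ (inj₂ (inj₁ p)))                     = pplus p
  decodeV (inj₂ (inj₂ (inj₂ (inj₁ p))))              = pminus p
  decodeV (inj₂ (inj₂ (inj₂ (inj₂ (inj₁ (p , z)))))) = x p z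
  decodeV (inj₂ (inj₂ (inj₂ (inj₂ (inj₂ n)))))       = node n

  decodeV-encodeV : ∀ v → decodeV (encodeV v) ≡ v
  decodeV-encodeV src        = refl
  decodeV-encodeV snk        = refl
  decodeV-encodeV (pplus p)  = refl
  decodeV-encodeV (pminus p) = refl
  decodeV-encodeV (x p z)    = refl
  decodeV-encodeV (node n)   = refl

  encodeA : Arc → El ArcShape
  encodeA (s→p+ p)   = inj₁ p
  encodeA (s→p- p)   = inj₂ (inj₁ p)
  encodeA (p+→x p z) = inj₂ (inj₂ (inj₁ (p , z)))
  encodeA (p-→x p z) = inj₂ (inj₂ (inj₂ (inj₁ (p , z))))
  encodeA (xn p n)   = inj₂ (inj₂ (inj₂ (inj₂ (inj₁ (p , n)))))
  encodeA (n→t n)    = inj₂ (inj₂ (inj₂ (inj₂ (inj₂ n))))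

  decodeA : El ArcShape → Arc
  decodeA (inj₁ p)                                   = s→p+ p
  decodeA (inj₂ (inj₁ p))                            = s→p- p
  decodeA (inj₂ (inj₂ (inj₁ (p , z))))               = p+→x p z
  decodeA (inj₂ (inj₂ (inj₂ (inj₁ (p , z)))))        = p-→x p z
  decodeA (inj₂ (inj₂ (inj₂ (inj₂ (inj₁ (p , n)))))) = xn p n
  decodeA (inj₂ (inj₂ (inj₂ (inj₂ (inj₂ n)))))       = n→t n

  decodeA-encodeA : ∀ e → decodeA (encodeA e) ≡ e
  decodeA-encodeA (s→p+ p)   = refl
  decodeA-encodeA (s→p- p)   = refl
  decodeA-encodeA (p+→x p z) = refl
  decodeA-encodeA (p-→x p z) = refl
  decodeA-encodeA (xn p n)   = refl
  decodeA-encodeA (n→t n)    = refl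

  encodeA-decodeA : ∀ c → encodeA (decodeA c) ≡ c
  encodeA-decodeA (inj₁ p)                                   = refl
  encodeA-decodeA (inj₂ (inj₁ p))                            = refl
  encodeA-decodeA (inj₂ (inj₂ (inj₁ (p , z))))               = refl
  encodeA-decodeA (inj₂ (inj₂ (inj₂ (inj₁ (p , z)))))        = refl
  encodeA-decodeA (inj₂ (inj₂ (inj₂ (inj₂ (inj₁ (p , n)))))) = refl
  encodeA-decodeA (inj₂ (inj₂ (inj₂ (inj₂ (inj₂ n)))))       = refl

  _≟V_ : DecidableEquality Vertex
  _≟V_ = ≟-via VertexShape encodeV decodeV decodeV-encodeV

  _≟A_ : DecidableEquality Arc
  _≟A_ = ≟-via ArcShape encodeA decodeA decodeA-encodeA

  _≟D_ : DecidableEquality Dir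
  fwd ≟D fwd = yes refl
  bwd ≟D bwd = yes refl
  fwd ≟D bwd = no λ ()
  bwd ≟D fwd = no λ ()

  -- directions are compared first, so that residual arcs of opposite directions are
  -- definitionally different
  _≟R_ : DecidableEquality RArc
  (e , d) ≟R (e′ , d′) =
    map′ (λ (d≡d′ , e≡e′) → cong₂ _,_ e≡e′ d≡d′) (λ eq → cong proj₂ eq , cong proj₁ eq)
         (d ≟D d′ ×-dec e ≟A e′)

  open import Data.List.Membership.DecPropositional _≟V_ using (_∈?_)

  vertices : List Vertex
  vertices = map decodeV (elements VertexShape)

  ∈-vertices : ∀ v → v ∈ vertices
  ∈-vertices v =
    subst (_∈ vertices) (decodeV-encodeV v) (∈-map⁺ decodeV (∈-elements VertexShape (encodeV v)))

  Σarcs : (Arc → ℕ) → ℕ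
  Σarcs h = Σ⟨ ArcShape ⟩ (h ∘ decodeA)

  Σarcs-cong : ∀ {h k : Arc → ℕ} → (∀ e → h e ≡ k e) → Σarcs h ≡ Σarcs k
  Σarcs-cong eq = Σ-cong ArcShape (eq ∘ decodeA)

  Σarcs-+ : ∀ (h k : Arc → ℕ) → Σarcs (λ e → h e + k e) ≡ Σarcs h + Σarcs k
  Σarcs-+ h k = Σ-+ ArcShape (h ∘ decodeA) (k ∘ decodeA)

  term≤Σarcs : ∀ (h : Arc → ℕ) e → h e ≤ Σarcs h
  term≤Σarcs h e =
    subst (_≤ Σarcs h) (cong h (decodeA-encodeA e)) (term≤Σ ArcShape (h ∘ decodeA) (encodeA e))

  Σarcs-positive : ∀ (h : Arc → ℕ) → 0 < Σarcs h → ∃ λ e → 0 < h e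
  Σarcs-positive h pos = Product.map decodeA id (Σ-positive ArcShape (h ∘ decodeA) pos)

  Σarcs-select : ∀ (h : Arc → ℕ) e₀ → Σarcs (λ e → [ does (e ≟A e₀) ]· h e) ≡ h e₀
  Σarcs-select h e₀ =
    trans (Σ-cong ArcShape (λ c → cong (λ c′ → [ does (≟-El ArcShape c′ (encodeA e₀)) ]· h (decodeA c))
                                       (encodeA-decodeA c)))
          (trans (Σ-select ArcShape (h ∘ decodeA) (encodeA e₀)) (cong h (decodeA-encodeA e₀)))

  flowAt : (Arc → Vertex) → (Arc → ℕ) → Vertex → ℕ
  flowAt end h v = Σarcs (λ e → [ does (end e ≟V v) ]· h e)

  inflow outflow : (Arc → ℕ) → Vertex → ℕ
  inflow  = flowAt head
  outflow = flowAt tail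

  flowAt-+ : ∀ end (h k : Arc → ℕ) v → flowAt end (λ e → h e + k e) v ≡ flowAt end h v + flowAt end k v
  flowAt-+ end h k v =
    trans (Σarcs-cong (λ e → []·-+ (does (end e ≟V v)) (h e) (k e)))
          (Σarcs-+ (λ e → [ does (end e ≟V v) ]· h e) (λ e → [ does (end e ≟V v) ]· k e))

  flowAt-positive : ∀ end (h : Arc → ℕ) v → 0 < flowAt end h v → ∃ λ e → end e ≡ v × 0 < h e
  flowAt-positive end h v pos =
    Product.map id (λ {e} → []·-positive (end e ≟V v))
                (Σarcs-positive (λ e → [ does (end e ≟V v) ]· h e) pos)

  term≤flowAt : ∀ end (h : Arc → ℕ) e → h e ≤ flowAt end h (end e)
  term≤flowAt end h e =
    subst (_≤ flowAt end h (end e)) (cong ([_]· h e) (dec-true (end e ≟V end e) refl))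
          (term≤Σarcs (λ e′ → [ does (end e′ ≟V end e) ]· h e′) e)

  -- the two sides of Conserved at each vertex
  arriving leaving : (Arc → ℕ) → Vertex → ℕ
  arriving h src        = 0
  arriving h snk        = ΣFin N (λ n → h (n→t n))
  arriving h (pplus p)  = h (s→p+ p)
  arriving h (pminus p) = h (s→p- p)
  arriving h (x p z)    = h (p+→x p z) + h (p-→x p z)
  arriving h (node n)   = ΣFin P (λ p → h (xn p n))
  leaving h src        = ΣFin P (λ p → h (s→p+ p) + h (s→p- p))
  leaving h snk        = 0
  leaving h (pplus p)  = ΣFin Z (λ z → h (p+→x p z))
  leaving h (pminus p) = ΣFin Z (λ z → h (p-→x p z))
  leaving h (x p z)    = ΣFin N (λ n → if ⌊ zone n Fin.≟ z ⌋ then h (xn p n) else 0)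
  leaving h (node n)   = h (n→t n)

  select-row : ∀ (g : Fin P → Fin Z → ℕ) p →
               Σ⟨ fin P ⊗ fin Z ⟩ (λ (q , z) → [ does (q Fin.≟ p) ]· g q z) ≡ ΣFin Z (g p)
  select-row g p =
    trans (Σ-cong (fin P) (λ q → Σ-[]· (fin Z) (does (q Fin.≟ p)) (g q))) (Σ-select (fin P) _ p)

  inflow-arriving : ∀ h v → inflow h v ≡ arriving h v
  inflow-arriving h src        = Σ-zero ArcShape
  inflow-arriving h snk        =
    cong₂ _+_ (Σ-zero (fin P)) (cong₂ _+_ (Σ-zero (fin P)) (cong₂ _+_ (Σ-zero (fin P ⊗ fin Z))
      (cong₂ _+_ (Σ-zero (fin P ⊗ fin Z)) (cong₂ _+_ (Σ-zero (fin P ⊗ fin N)) refl))))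
  inflow-arriving h (pplus p)  =
    trans (cong₂ _+_ (Σ-select (fin P) _ p)
                     (Σ-zero (fin P ⊕ fin P ⊗ fin Z ⊕ fin P ⊗ fin Z ⊕ fin P ⊗ fin N ⊕ fin N)))
          (+-identityʳ _)
  inflow-arriving h (pminus p) =
    cong₂ _+_ (Σ-zero (fin P))
      (trans (cong₂ _+_ (Σ-select (fin P) _ p)
                        (Σ-zero (fin P ⊗ fin Z ⊕ fin P ⊗ fin Z ⊕ fin P ⊗ fin N ⊕ fin N)))
             (+-identityʳ _))
  inflow-arriving h (x p z)    =
    cong₂ _+_ (Σ-zero (fin P)) (cong₂ _+_ (Σ-zero (fin P)) (cong₂ _+_ (Σ-select (fin P ⊗ fin Z) _ (p , z))
      (trans (cong₂ _+_ (Σ-select (fin P ⊗ fin Z) _ (p , z)) (Σ-zero (fin P ⊗ fin N ⊕ fin N)))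
             (+-identityʳ _))))
  inflow-arriving h (node n)   =
    cong₂ _+_ (Σ-zero (fin P)) (cong₂ _+_ (Σ-zero (fin P)) (cong₂ _+_ (Σ-zero (fin P ⊗ fin Z))
      (cong₂ _+_ (Σ-zero (fin P ⊗ fin Z))
        (trans (cong₂ _+_ (Σ-cong (fin P) (λ q → Σ-select (fin N) _ n)) (Σ-zero (fin N))) (+-identityʳ _)))))

  outflow-leaving : ∀ h v → outflow h v ≡ leaving h v
  outflow-leaving h src        =
    trans (cong (Σ⟨ fin P ⟩ (h ∘ s→p+) +_)
                (trans (cong (Σ⟨ fin P ⟩ (h ∘ s→p-) +_)
                             (Σ-zero (fin P ⊗ fin Z ⊕ fin P ⊗ fin Z ⊕ fin P ⊗ fin N ⊕ fin N)))
                       (+-identityʳ _)))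
          (sym (Σ-+ (fin P) (h ∘ s→p+) (h ∘ s→p-)))
  outflow-leaving h snk        = Σ-zero ArcShape
  outflow-leaving h (pplus p)  =
    cong₂ _+_ (Σ-zero (fin P)) (cong₂ _+_ (Σ-zero (fin P))
      (trans (cong₂ _+_ (select-row (λ q z → h (p+→x q z)) p)
                        (Σ-zero (fin P ⊗ fin Z ⊕ fin P ⊗ fin N ⊕ fin N)))
             (+-identityʳ _)))
  outflow-leaving h (pminus p) =
    cong₂ _+_ (Σ-zero (fin P)) (cong₂ _+_ (Σ-zero (fin P)) (cong₂ _+_ (Σ-zero (fin P ⊗ fin Z))
      (trans (cong₂ _+_ (select-row (λ q z → h (p-→x q z)) p) (Σ-zero (fin P ⊗ fin N ⊕ fin N)))
             (+-identityʳ _))))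
  outflow-leaving h (x p z)    =
    cong₂ _+_ (Σ-zero (fin P)) (cong₂ _+_ (Σ-zero (fin P)) (cong₂ _+_ (Σ-zero (fin P ⊗ fin Z))
      (cong₂ _+_ (Σ-zero (fin P ⊗ fin Z)) (trans (cong₂ _+_ row (Σ-zero (fin N))) (+-identityʳ _)))))
    where
    row : Σ⟨ fin P ⊗ fin N ⟩ (λ (q , n) → [ does (q Fin.≟ p) ∧ does (zone n Fin.≟ z) ]· h (xn q n))
          ≡ leaving h (x p z)
    row = trans (Σ-cong (fin P) (λ q → Σ-[∧]· (fin N) _ (λ n → does (zone n Fin.≟ z))
                                                        (λ n → h (xn q n))))
          (trans (Σ-select (fin P) _ p)
                 (Σ-cong (fin N) (λ n → cong ([_]· h (xn p n)) (sym (isYes≗does (zone n Fin.≟ z))))))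
  outflow-leaving h (node n)   =
    cong₂ _+_ (Σ-zero (fin P)) (cong₂ _+_ (Σ-zero (fin P)) (cong₂ _+_ (Σ-zero (fin P ⊗ fin Z))
      (cong₂ _+_ (Σ-zero (fin P ⊗ fin Z)) (cong₂ _+_ (Σ-zero (fin P ⊗ fin N)) (Σ-select (fin N) _ n)))))

  conserved⇒balanced : ∀ h v → arriving h v ≡ leaving h v → inflow h v ≡ outflow h v
  conserved⇒balanced h v eq = trans (inflow-arriving h v) (trans eq (sym (outflow-leaving h v)))

  balanced⇒conserved : ∀ h v → inflow h v ≡ outflow h v → arriving h v ≡ leaving h v
  balanced⇒conserved h v eq = trans (sym (inflow-arriving h v)) (trans eq (outflow-leaving h v))

  value≡outflow-src : ∀ g → value g ≡ outflow (flow g) src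
  value≡outflow-src g = sym (outflow-leaving (flow g) src)

  value≡inflow-snk : ∀ g → value g ≡ inflow (flow g) snk
  value≡inflow-snk g = begin
    ΣFin P (λ p → flow g (s→p+ p) + flow g (s→p- p))
      ≡⟨ Σ-cong (fin P) (λ p → cong₂ _+_ (conserved g (pplus p)) (conserved g (pminus p))) ⟩
    ΣFin P (λ p → ΣFin Z (λ z → flow g (p+→x p z)) + ΣFin Z (λ z → flow g (p-→x p z)))
      ≡⟨ Σ-cong (fin P) (λ p → sym (Σ-+ (fin Z) _ _)) ⟩
    ΣFin P (λ p → ΣFin Z (λ z → flow g (p+→x p z) + flow g (p-→x p z)))
      ≡⟨ Σ-cong (fin P) (λ p → Σ-cong (fin Z) (λ z → conserved g (x p z))) ⟩
    ΣFin P (λ p → ΣFin Z (λ z → ΣFin N (λ n → if ⌊ zone n Fin.≟ z ⌋ then flow g (xn p n) else 0)))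
      ≡⟨ Σ-cong (fin P) (λ p → Σ-swap (fin Z) (fin N) _) ⟩
    ΣFin P (λ p → ΣFin N (λ n → ΣFin Z (λ z → if ⌊ zone n Fin.≟ z ⌋ then flow g (xn p n) else 0)))
      ≡⟨ Σ-cong (fin P) (λ p → Σ-cong (fin N) (λ n →
           Σ-select′ (fin Z) (λ _ → flow g (xn p n)) (zone n))) ⟩
    ΣFin P (λ p → ΣFin N (λ n → flow g (xn p n)))
      ≡⟨ Σ-swap (fin P) (fin N) _ ⟩
    ΣFin N (λ n → ΣFin P (λ p → flow g (xn p n)))
      ≡⟨ Σ-cong (fin N) (λ n → conserved g (node n)) ⟩
    ΣFin N (λ n → flow g (n→t n))
      ≡⟨ sym (inflow-arriving (flow g) snk) ⟩
    inflow (flow g) snk ∎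
    where open ≡-Reasoning

  SameExcess : (Arc → ℕ) → (Arc → ℕ) → Set
  SameExcess h k = ∀ v → inflow h v + outflow k v ≡ inflow k v + outflow h v

  SameExcess-sym : ∀ {h k} → SameExcess h k → SameExcess k h
  SameExcess-sym same v = sym (same v)

  SameExcess-transfer : ∀ {h₁ h₂ k₁ k₂ : Arc → ℕ} → (∀ e → h₁ e + k₁ e ≡ h₂ e + k₂ e) →
                        SameExcess h₁ h₂ ⇔ SameExcess k₁ k₂
  SameExcess-transfer {h₁} {h₂} {k₁} {k₂} eq =
    mk⇔ (λ same v → Equivalence.to (transfer v) (same v)) (λ same v → Equivalence.from (transfer v) (same v))
    where
    moved : ∀ end v → flowAt end h₁ v + flowAt end k₁ v ≡ flowAt end h₂ v + flowAt end k₂ v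
    moved end v = trans (sym (flowAt-+ end h₁ k₁ v))
                        (trans (Σarcs-cong (λ e → cong ([ does (end e ≟V v) ]·_) (eq e)))
                               (flowAt-+ end h₂ k₂ v))
    transfer : ∀ v → (inflow h₁ v + outflow h₂ v ≡ inflow h₂ v + outflow h₁ v)
                   ⇔ (inflow k₁ v + outflow k₂ v ≡ inflow k₂ v + outflow k₁ v)
    transfer v = balance-transfer (inflow h₁ v) (inflow h₂ v) (outflow h₁ v) (outflow h₂ v)
                                  (inflow k₁ v) (inflow k₂ v) (outflow k₁ v) (outflow k₂ v)
                                  (moved head v) (moved tail v)

  SameExcess-conserved : (f g : Flow) → ∀ v → arriving (flow f) v ≡ leaving (flow f) v →
                         arriving (flow g) v ≡ leaving (flow g) v →
                         inflow (flow f) v + outflow (flow g) v ≡ inflow (flow g) v + outflow (flow f) v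
  SameExcess-conserved f g v cf cg = cross-sum (conserved⇒balanced _ v cf) (conserved⇒balanced _ v cg)

  SameExcess-of-value : (f g : Flow) → value f ≡ value g → SameExcess (flow f) (flow g)
  SameExcess-of-value f g eq src = begin
    inflow (flow f) src + outflow (flow g) src
      ≡⟨ cong₂ _+_ (inflow-arriving (flow f) src) (sym (value≡outflow-src g)) ⟩
    value g
      ≡⟨ sym eq ⟩
    value f
      ≡⟨ cong₂ _+_ (sym (inflow-arriving (flow g) src)) (value≡outflow-src f) ⟩
    inflow (flow g) src + outflow (flow f) src ∎
    where open ≡-Reasoning
  SameExcess-of-value f g eq snk = begin
    inflow (flow f) snk + outflow (flow g) snk
      ≡⟨ cong₂ _+_ (sym (value≡inflow-snk f)) (outflow-leaving (flow g) snk) ⟩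
    value f + 0
      ≡⟨ cong (_+ 0) eq ⟩
    value g + 0
      ≡⟨ cong₂ _+_ (value≡inflow-snk g) (sym (outflow-leaving (flow f) snk)) ⟩
    inflow (flow g) snk + outflow (flow f) snk ∎
    where open ≡-Reasoning
  SameExcess-of-value f g eq (pplus p) =
    SameExcess-conserved f g (pplus p) (conserved f (pplus p)) (conserved g (pplus p))
  SameExcess-of-value f g eq (pminus p) =
    SameExcess-conserved f g (pminus p) (conserved f (pminus p)) (conserved g (pminus p))
  SameExcess-of-value f g eq (x p z) =
    SameExcess-conserved f g (x p z) (conserved f (x p z)) (conserved g (x p z))
  SameExcess-of-value f g eq (node n) =
    SameExcess-conserved f g (node n) (conserved f (node n)) (conserved g (node n))

  asFlow : (f : Flow) (h : Arc → ℕ) → (∀ e → h e ≤ capacity e) → SameExcess (flow f) h → Flow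
  asFlow f h h≤c same = record { flow = h ; bounded = h≤c ; conserved = conserved-h }
    where
    transferred : ∀ v → arriving (flow f) v ≡ leaving (flow f) v → arriving h v ≡ leaving h v
    transferred v cf = balanced⇒conserved h v (cross-cancel (same v) (conserved⇒balanced (flow f) v cf))
    conserved-h : ∀ v → Conserved h v
    conserved-h src        = tt
    conserved-h snk        = tt
    conserved-h (pplus p)  = transferred (pplus p) (conserved f (pplus p))
    conserved-h (pminus p) = transferred (pminus p) (conserved f (pminus p))
    conserved-h (x p z)    = transferred (x p z) (conserved f (x p z))
    conserved-h (node n)   = transferred (node n) (conserved f (node n))

  value-asFlow : ∀ f h h≤c same → value (asFlow f h h≤c same) ≡ value f
  value-asFlow f h h≤c same = begin
    leaving h src                       ≡⟨ sym (outflow-leaving h src) ⟩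
    0 + outflow h src                   ≡⟨ cong (_+ outflow h src) (sym (inflow-arriving (flow f) src)) ⟩
    inflow (flow f) src + outflow h src ≡⟨ same src ⟩
    inflow h src + outflow (flow f) src ≡⟨ cong₂ _+_ (inflow-arriving h src) (sym (value≡outflow-src f)) ⟩
    value f                             ∎
    where open ≡-Reasoning

  -- Closed walks

  count : List RArc → RArc → ℕ
  count c a = ΣList c (λ b → ⟦ does (a ≟R b) ⟧)

  along against uses : List RArc → Arc → ℕ
  along   c e = count c (e , fwd)
  against c e = count c (e , bwd)
  uses    c e = along c e + against c e

  Σarcs-selectᴿ : ∀ (φ : RArc → ℕ) a →
                  Σarcs (λ e → ⟦ does ((e , fwd) ≟R a) ⟧ * φ (e , fwd)
                             + ⟦ does ((e , bwd) ≟R a) ⟧ * φ (e , bwd))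
                  ≡ φ a
  Σarcs-selectᴿ φ (e₀ , fwd) =
    trans (Σarcs-cong (λ e → trans (+-identityʳ _) (⟦⟧-* (does (e ≟A e₀)) (φ (e , fwd)))))
          (Σarcs-select (λ e → φ (e , fwd)) e₀)
  Σarcs-selectᴿ φ (e₀ , bwd) =
    trans (Σarcs-cong (λ e → ⟦⟧-* (does (e ≟A e₀)) (φ (e , bwd))))
          (Σarcs-select (λ e → φ (e , bwd)) e₀)

  ΣList-count : ∀ c (φ : RArc → ℕ) →
                ΣList c φ ≡ Σarcs (λ e → along c e * φ (e , fwd) + against c e * φ (e , bwd))
  ΣList-count []      φ = sym (Σ-zero ArcShape)
  ΣList-count (a ∷ c) φ = begin
    φ a + ΣList c φ
      ≡⟨ cong₂ _+_ (sym (Σarcs-selectᴿ φ a)) (ΣList-count c φ) ⟩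
    Σarcs step + Σarcs later
      ≡⟨ sym (Σarcs-+ step later) ⟩
    Σarcs (λ e → step e + later e)
      ≡⟨ Σarcs-cong (λ e → trans (interchange (δ e fwd * φ (e , fwd)) (δ e bwd * φ (e , bwd))
                                              (along c e * φ (e , fwd)) (against c e * φ (e , bwd)))
                               (sym (cong₂ _+_ (*-distribʳ-+ (φ (e , fwd)) (δ e fwd) (along c e))
                                               (*-distribʳ-+ (φ (e , bwd)) (δ e bwd) (against c e))))) ⟩
    Σarcs (λ e → along (a ∷ c) e * φ (e , fwd) + against (a ∷ c) e * φ (e , bwd)) ∎
    where
    open ≡-Reasoning
    δ : Arc → Dir → ℕ
    δ e d = ⟦ does ((e , d) ≟R a) ⟧
    step later : Arc → ℕ
    step e = δ e fwd * φ (e , fwd) + δ e bwd * φ (e , bwd)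
    later e = along c e * φ (e , fwd) + against c e * φ (e , bwd)

  heads tails : List RArc → Vertex → ℕ
  heads c v = ΣList c (λ a → ⟦ does (rhead a ≟V v) ⟧)
  tails c v = ΣList c (λ a → ⟦ does (rtail a ≟V v) ⟧)

  heads-flow : ∀ c v → heads c v ≡ inflow (along c) v + outflow (against c) v
  heads-flow c v =
    trans (ΣList-count c (λ a → ⟦ does (rhead a ≟V v) ⟧))
          (trans (Σarcs-cong (λ e → cong₂ _+_ (*-⟦⟧ (along c e) (does (head e ≟V v)))
                                              (*-⟦⟧ (against c e) (does (tail e ≟V v)))))
                 (Σarcs-+ (λ e → [ does (head e ≟V v) ]· along c e)
                          (λ e → [ does (tail e ≟V v) ]· against c e)))

  tails-flow : ∀ c v → tails c v ≡ outflow (along c) v + inflow (against c) v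
  tails-flow c v =
    trans (ΣList-count c (λ a → ⟦ does (rtail a ≟V v) ⟧))
          (trans (Σarcs-cong (λ e → cong₂ _+_ (*-⟦⟧ (along c e) (does (tail e ≟V v)))
                                              (*-⟦⟧ (against c e) (does (head e ≟V v)))))
                 (Σarcs-+ (λ e → [ does (tail e ≟V v) ]· along c e)
                          (λ e → [ does (head e ≟V v) ]· against c e)))

  path-heads-tails : ∀ v b as → Linked (b ∷ as) →
                     heads (b ∷ as) v + ⟦ does (rtail b ≟V v) ⟧
                     ≡ tails (b ∷ as) v + ⟦ does (rhead (lastOf b as) ≟V v) ⟧
  path-heads-tails v b [] _ =
    trans (cong (_+ ⟦ does (rtail b ≟V v) ⟧) (+-identityʳ _))
          (trans (+-comm ⟦ does (rhead b ≟V v) ⟧ _)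
                 (cong (_+ ⟦ does (rhead b ≟V v) ⟧) (sym (+-identityʳ _))))
  path-heads-tails v b (a ∷ as) (b→a , L) = begin
    (⟦ does (rhead b ≟V v) ⟧ + H) + tb ≡⟨ cong (λ u → (⟦ does (u ≟V v) ⟧ + H) + tb) b→a ⟩
    (ta + H) + tb                      ≡⟨ cong (_+ tb) (trans (+-comm ta H) (path-heads-tails v a as L)) ⟩
    (T + hl) + tb                      ≡⟨ trans (+-comm (T + hl) tb) (sym (+-assoc tb T hl)) ⟩
    (tb + T) + hl                      ∎
    where
    open ≡-Reasoning
    H T ta tb hl : ℕ
    H  = heads (a ∷ as) v
    T  = tails (a ∷ as) v
    ta = ⟦ does (rtail a ≟V v) ⟧
    tb = ⟦ does (rtail b ≟V v) ⟧
    hl = ⟦ does (rhead (lastOf a as) ≟V v) ⟧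

  closedWalk-SameExcess : ∀ {b as} → Linked (b ∷ as) → rhead (lastOf b as) ≡ rtail b →
                          SameExcess (along (b ∷ as)) (against (b ∷ as))
  closedWalk-SameExcess {b} {as} L closed v = begin
    inflow (along c) v + outflow (against c) v ≡⟨ sym (heads-flow c v) ⟩
    heads c v                                  ≡⟨ +-cancelʳ-≡ ⟦ does (rtail b ≟V v) ⟧ _ _ heads≡tails ⟩
    tails c v                                  ≡⟨ tails-flow c v ⟩
    outflow (along c) v + inflow (against c) v ≡⟨ +-comm (outflow (along c) v) (inflow (against c) v) ⟩
    inflow (against c) v + outflow (along c) v ∎
    where
    open ≡-Reasoning
    c : List RArc
    c = b ∷ as
    heads≡tails : heads c v + ⟦ does (rtail b ≟V v) ⟧ ≡ tails c v + ⟦ does (rtail b ≟V v) ⟧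
    heads≡tails = trans (path-heads-tails v b as L) (cong (λ u → tails c v + ⟦ does (u ≟V v) ⟧) closed)

  count-absent : ∀ c a → All (rtail a ≢_) (map rtail c) → count c a ≡ 0
  count-absent []      a _           = refl
  count-absent (b ∷ c) a (a≢b ∷ a∉c) =
    cong₂ _+_ (cong ⟦_⟧ (dec-false (a ≟R b) (a≢b ∘ cong rtail))) (count-absent c a a∉c)

  count≤1 : ∀ c a → Unique (map rtail c) → count c a ≤ 1
  count≤1 []      a _         = z≤n
  count≤1 (b ∷ c) a (b∉c ∷ u) with a ≟R b
  ... | yes refl = subst (λ k → ⟦ does (a ≟R a) ⟧ + k ≤ 1) (sym (count-absent c a b∉c))
                         (subst (_≤ 1) (sym (+-identityʳ _)) (⟦⟧≤1 (does (a ≟R a))))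
  ... | no  a≢b  = subst (λ t → ⟦ t ⟧ + count c a ≤ 1) (sym (dec-false (a ≟R b) a≢b)) (count≤1 c a u)

  count-positive⇒∈ : ∀ c a → 0 < count c a → a ∈ c
  count-positive⇒∈ (b ∷ c) a pos with a ≟R b
  ... | yes a≡b = here a≡b
  ... | no  a≢b =
    there (count-positive⇒∈ c a (subst (λ t → 0 < ⟦ t ⟧ + count c a) (dec-false (a ≟R b) a≢b) pos))

  count-head : ∀ a c → 0 < count (a ∷ c) a
  count-head a c = subst (λ t → 0 < ⟦ t ⟧ + count c a) (sym (dec-true (a ≟R a) refl)) (s≤s z≤n)

  counted⇒used : ∀ c e d → 0 < count c (e , d) → 0 < uses c e
  counted⇒used c e fwd pos = ≤-trans pos (m≤m+n _ _)
  counted⇒used c e bwd pos = ≤-trans pos (m≤n+m _ _)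

  -- Augmenting along cycles

  record Augmentation (f : Flow) : Set where
    field
      raise lower    : Arc → ℕ
      balanced       : SameExcess raise lower
      raise≤1        : ∀ e → raise e ≤ 1
      lower≤1        : ∀ e → lower e ≤ 1
      raise-residual : ∀ e → 0 < raise e → InResidual f (e , fwd)
      lower-residual : ∀ e → 0 < lower e → InResidual f (e , bwd)

    augmented : Arc → ℕ
    augmented e = flow f e + raise e ∸ lower e

    lower≤ : ∀ e → lower e ≤ flow f e + raise e
    lower≤ e = ≤-trans (≤1⇒≤ (lower≤1 e) (lower-residual e)) (m≤m+n _ _)

    augmented-bounded : ∀ e → augmented e ≤ capacity e
    augmented-bounded e =
      ≤-trans (m∸n≤m (flow f e + raise e) (lower e)) (+≤1⇒≤ (raise≤1 e) (raise-residual e) (bounded f e))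

    augmented-SameExcess : SameExcess (flow f) augmented
    augmented-SameExcess =
      SameExcess-sym {augmented} {flow f}
        (Equivalence.from (SameExcess-transfer {augmented} {flow f} {lower} {raise} (λ e → m∸n+n≡m (lower≤ e)))
                          (SameExcess-sym {raise} {lower} balanced))

    augment : Flow
    augment = asFlow f augmented augmented-bounded augmented-SameExcess

    value-augment : value augment ≡ value f
    value-augment = value-asFlow f augmented augmented-bounded augmented-SameExcess

  record Cycle (S : RArc → Set) : Set where
    field
      first  : RArc
      rest   : List RArc
      all-S  : All S (first ∷ rest)
      linked : Linked (first ∷ rest)
      closed : rhead (lastOf first rest) ≡ rtail first
      simple : Unique (map rtail (first ∷ rest))

    arcs : List RArc
    arcs = first ∷ rest

    counted⇒S : ∀ a → 0 < count arcs a → S a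
    counted⇒S a pos = All.lookup all-S (count-positive⇒∈ arcs a pos)

    counted≤1 : ∀ a → count arcs a ≤ 1
    counted≤1 a = count≤1 arcs a simple

    balanced : SameExcess (along arcs) (against arcs)
    balanced = closedWalk-SameExcess linked closed

    first-used : 0 < uses arcs (proj₁ first)
    first-used = counted⇒used arcs (proj₁ first) (proj₂ first) (count-head first rest)

  cycleAugmentation : ∀ {f} → Cycle (InResidual f) → Augmentation f
  cycleAugmentation C = record
    { raise          = along arcs
    ; lower          = against arcs
    ; balanced       = balanced
    ; raise≤1        = λ e → counted≤1 (e , fwd)
    ; lower≤1        = λ e → counted≤1 (e , bwd)
    ; raise-residual = λ e → counted⇒S (e , fwd)
    ; lower-residual = λ e → counted⇒S (e , bwd)
    }
    where open Cycle C

  onXn : (Fin P → Fin N → ℕ) → Arc → ℕ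
  onXn ψ (xn p n) = ψ p n
  onXn ψ _        = 0

  *-onXn : ∀ (k : Arc → ℕ) ψ e → k e * onXn ψ e ≡ onXn (λ p n → k (xn p n) * ψ p n) e
  *-onXn k ψ (s→p+ _)   = *-zeroʳ (k _)
  *-onXn k ψ (s→p- _)   = *-zeroʳ (k _)
  *-onXn k ψ (p+→x _ _) = *-zeroʳ (k _)
  *-onXn k ψ (p-→x _ _) = *-zeroʳ (k _)
  *-onXn k ψ (xn p n)   = refl
  *-onXn k ψ (n→t _)    = *-zeroʳ (k _)

  Σarcs-onXn : ∀ ψ → Σarcs (onXn ψ) ≡ Σ⟨ fin P ⊗ fin N ⟩ (uncurry ψ)
  Σarcs-onXn ψ =
    cong₂ _+_ (Σ-zero (fin P)) (cong₂ _+_ (Σ-zero (fin P)) (cong₂ _+_ (Σ-zero (fin P ⊗ fin Z))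
      (cong₂ _+_ (Σ-zero (fin P ⊗ fin Z))
        (trans (cong (Σ⟨ fin P ⊗ fin N ⟩ (uncurry ψ) +_) (Σ-zero (fin N))) (+-identityʳ _)))))

  ΣList-onXn : ∀ c ψ →
               ΣList c (onXn ψ ∘ proj₁) ≡ Σ⟨ fin P ⊗ fin N ⟩ (λ (p , n) → uses c (xn p n) * ψ p n)
  ΣList-onXn c ψ = begin
    ΣList c (onXn ψ ∘ proj₁)
      ≡⟨ ΣList-count c (onXn ψ ∘ proj₁) ⟩
    Σarcs (λ e → along c e * onXn ψ e + against c e * onXn ψ e)
      ≡⟨ Σarcs-cong (λ e → trans (sym (*-distribʳ-+ (onXn ψ e) (along c e) (against c e)))
                                 (*-onXn (uses c) ψ e)) ⟩
    Σarcs (onXn (λ p n → uses c (xn p n) * ψ p n))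
      ≡⟨ Σarcs-onXn (λ p n → uses c (xn p n) * ψ p n) ⟩
    Σ⟨ fin P ⊗ fin N ⟩ (λ (p , n) → uses c (xn p n) * ψ p n) ∎
    where open ≡-Reasoning

  -- Cycles in the support of g − f

  Supported : Flow → Flow → RArc → Set
  Supported f g (e , fwd) = flow f e < flow g e
  Supported f g (e , bwd) = flow g e < flow f e

  supported⇒residual : ∀ f g a → Supported f g a → InResidual f a
  supported⇒residual f g (e , fwd) f<g = <-≤-trans f<g (bounded g e)
  supported⇒residual f g (e , bwd) g<f = ≤-<-trans z≤n g<f

  -- as f and g have the same value, g − f has excess 0 at every vertex, so a supported arc
  -- leaving a vertex forces a supported arc entering it
  supported-predecessor : (f g : Flow) → value f ≡ value g →
                          ∀ a → Supported f g a → ∃ λ b → rhead b ≡ rtail a × Supported f g b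
  supported-predecessor f g same a sup
    with +-<⇒<⊎< {0} {0} (subst (0 <_) (sym (excess (rtail a))) (departing a sup))
    where
    above below : Arc → ℕ
    above e = flow g e ∸ flow f e
    below e = flow f e ∸ flow g e
    excess : SameExcess above below
    excess = Equivalence.to (SameExcess-transfer {flow f} {flow g} {above} {below}
                                                 (λ e → m+[n∸m]≡n+[m∸n] (flow f e) (flow g e)))
                            (SameExcess-of-value f g same)
    departing : ∀ a → Supported f g a → 0 < inflow below (rtail a) + outflow above (rtail a)
    departing (e , fwd) f<g =
      ≤-trans (≤-trans (m<n⇒0<n∸m f<g) (term≤flowAt tail above e)) 
              (m≤n+m (outflow above (tail e)) (inflow below (tail e)))
    departing (e , bwd) g<f =
      ≤-trans (≤-trans (m<n⇒0<n∸m g<f) (term≤flowAt head below e)) 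
              (m≤m+n (inflow below (head e)) (outflow above (head e)))
  ... | inj₁ into with flowAt-positive head _ (rtail a) into
  ...   | e , head≡ , pos = (e , fwd) , head≡ , 0<∸⇒< (flow f e) (flow g e) pos
  supported-predecessor f g same a sup | inj₂ out with flowAt-positive tail _ (rtail a) out
  ...   | e , tail≡ , pos = (e , bwd) , tail≡ , 0<∸⇒< (flow g e) (flow f e) pos

  prefix-to : ∀ w b as → Linked (b ∷ as) → Unique (map rtail as) → w ∈ map rtail as →
              ∃ λ pre → pre ⊆ as × Linked (b ∷ pre) × rhead (lastOf b pre) ≡ w
                        × All (w ≢_) (map rtail pre) × Unique (map rtail pre)
  prefix-to w b (a ∷ as) (b→a , _) _ (here w≡a) = [] , minimum _ , tt , trans b→a (sym w≡a) , [] , []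
  prefix-to w b (a ∷ as) (b→a , L) (a∉as ∷ u) (there w∈as) with prefix-to w a as L u w∈as
  ... | pre , pre⊆as , L′ , closes , w∉pre , u′ =
    a ∷ pre , refl ∷ pre⊆as , (b→a , L′) , closes ,
    (λ w≡a → All.lookup a∉as w∈as (sym w≡a)) ∷ w∉pre ,
    AllP.map⁺ (All-resp-⊆ pre⊆as (AllP.map⁻ a∉as)) ∷ u′

  module _ (S : RArc → Set) (predecessor : ∀ a → S a → ∃ λ b → rhead b ≡ rtail a × S b) where

    -- walk backwards through S-arcs until a vertex repeats, which happens within |vertices| steps
    grow : ∀ fuel b as → length vertices < fuel + length (b ∷ as) →
           All S (b ∷ as) → Linked (b ∷ as) → Unique (map rtail (b ∷ as)) → Cycle S
    grow zero b as long _ _ u =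
      contradiction (subst (_≤ length vertices) (length-map rtail (b ∷ as))
                           (Unique⇒length≤ u (All.tabulate (λ {v} _ → ∈-vertices v))))
                    (<⇒≱ long)
    grow (suc fuel) b as long all-S L u with predecessor b (All.head all-S)
    ... | b′ , b′→b , Sb′ with rtail b′ ∈? map rtail (b ∷ as)
    ...   | yes w∈ with prefix-to (rtail b′) b′ (b ∷ as) (b′→b , L) u w∈
    ...     | pre , pre⊆ , L′ , closes , w∉pre , u′ = record
      { first = b′ ; rest = pre ; all-S = Sb′ ∷ All-resp-⊆ pre⊆ all-S
      ; linked = L′ ; closed = closes ; simple = w∉pre ∷ u′ }
    grow (suc fuel) b as long all-S L u | b′ , b′→b , Sb′ | no w∉ =
      grow fuel b′ (b ∷ as) (subst (length vertices <_) (sym (+-suc fuel (length (b ∷ as)))) long)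
           (Sb′ ∷ all-S) (b′→b , L) (AllP.¬Any⇒All¬ _ w∉ ∷ u)

    findCycle : ∀ {a} → S a → Cycle S
    findCycle {a} Sa = grow (suc (length vertices)) a [] (≤-trans (n<1+n _) (m≤m+n _ 1)) (Sa ∷ []) tt ([] ∷ [])

  residual-cycle : ∀ {f g} (C : Cycle (Supported f g)) → IsCycle f (Cycle.arcs C)
  residual-cycle {f} {g} C = All.map (λ {a} → supported⇒residual f g a) all-S , linked , closed , simple
    where open Cycle C

  -- the cycle traversed backwards in g, which moves g towards f on every arc it crosses
  cancellation : ∀ {f g} → Cycle (Supported f g) → Augmentation g
  cancellation {f} {g} C = record
    { raise          = against arcs
    ; lower          = along arcs
    ; balanced       = SameExcess-sym {along arcs} {against arcs} balanced
    ; raise≤1        = λ e → counted≤1 (e , bwd)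
    ; lower≤1        = λ e → counted≤1 (e , fwd)
    ; raise-residual = λ e pos → <-≤-trans (counted⇒S (e , bwd) pos) (bounded f e)
    ; lower-residual = λ e pos → ≤-<-trans z≤n (counted⇒S (e , fwd) pos)
    }
    where open Cycle C

  gap : Flow → Flow → ℕ
  gap f g = Σarcs (λ e → ∣ flow g e - flow f e ∣)

  gap-cancellation : ∀ {f g} (C : Cycle (Supported f g)) → gap f (Augmentation.augment (cancellation C)) < gap f g
  gap-cancellation {f} {g} C =
    subst (gap f g′ <_) moved (m<m+n (gap f g′) (≤-trans first-used (term≤Σarcs (uses arcs) (proj₁ first))))
    where
    open Cycle C
    g′ : Flow
    g′ = Augmentation.augment (cancellation C)
    moved : gap f g′ + Σarcs (uses arcs) ≡ gap f g
    moved = trans (sym (Σarcs-+ (λ e → ∣ flow g′ e - flow f e ∣) (uses arcs)))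
                  (Σarcs-cong (λ e → cancel-gap (counted≤1 (e , fwd)) (counted≤1 (e , bwd))
                                                (counted⇒S (e , fwd)) (counted⇒S (e , bwd))))

  -- Weights and the distance to the reference assignment

  module Weights (α : Assignment) where

    mismatch : (Arc → ℕ) → Fin P → Fin N → Bool
    mismatch h p n = one? (h (xn p n)) xor α p n

    mismatches : (Arc → ℕ) → ℕ
    mismatches h = Σ⟨ fin P ⊗ fin N ⟩ (λ (p , n) → ⟦ mismatch h p n ⟧)

    mismatched matched : (Arc → ℕ) → (Arc → ℕ) → ℕ
    mismatched k r = Σ⟨ fin P ⊗ fin N ⟩ (λ (p , n) → k (xn p n) * ⟦ mismatch r p n ⟧)
    matched    k r = Σ⟨ fin P ⊗ fin N ⟩ (λ (p , n) → k (xn p n) * ⟦ not (mismatch r p n) ⟧)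

    mismatches-crossing : ∀ (h h′ r k : Arc → ℕ) →
                          (∀ p n → Crossing (h (xn p n)) (h′ (xn p n)) (r (xn p n)) (k (xn p n))) →
                          mismatches h′ + mismatched k r ≡ mismatches h + matched k r
    mismatches-crossing h h′ r k cross =
      trans (sym (Σ-+ (fin P ⊗ fin N) (λ (p , n) → ⟦ mismatch h′ p n ⟧)
                                      (λ (p , n) → k (xn p n) * ⟦ mismatch r p n ⟧)))
        (trans (Σ-cong (fin P ⊗ fin N) (λ (p , n) → crossing-mismatch (α p n) (cross p n)))
               (Σ-+ (fin P ⊗ fin N) (λ (p , n) → ⟦ mismatch h p n ⟧)
                                    (λ (p , n) → k (xn p n) * ⟦ not (mismatch r p n) ⟧)))

    negatives positives : Flow → List RArc → ℕ
    negatives f c = ΣList c (onXn (λ p n → ⟦ mismatch (flow f) p n ⟧) ∘ proj₁)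
    positives f c = ΣList c (onXn (λ p n → ⟦ not (mismatch (flow f) p n) ⟧) ∘ proj₁)

    weight-split : ∀ f c → ℤ.+ negatives f c ℤ.+ totalWeight f α c ≡ ℤ.+ positives f c
    weight-split f []      = refl
    weight-split f (a ∷ c) =
      trans (ℤ-interchange (ℤ.+ negative a) (ℤ.+ negatives f c) (weight f α a) (totalWeight f α c))
            (cong₂ ℤ._+_ (arc-split a) (weight-split f c))
      where
      negative positive : RArc → ℕ
      negative = onXn (λ p n → ⟦ mismatch (flow f) p n ⟧) ∘ proj₁
      positive = onXn (λ p n → ⟦ not (mismatch (flow f) p n) ⟧) ∘ proj₁
      arc-split : ∀ a → ℤ.+ negative a ℤ.+ weight f α a ≡ ℤ.+ positive a
      arc-split (s→p+ _   , _) = refl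
      arc-split (s→p- _   , _) = refl
      arc-split (p+→x _ _ , _) = refl
      arc-split (p-→x _ _ , _) = refl
      arc-split (n→t _    , _) = refl
      arc-split (xn p n   , _) with one? (flow f (xn p n)) xor α p n
      ... | true  = refl
      ... | false = refl

    negative⇒ : ∀ f c → totalWeight f α c ℤ.< ℤ.0ℤ → positives f c < negatives f c
    negative⇒ f c neg =
      ℤP.drop‿+<+ (subst₂ ℤ._<_ (weight-split f c) (ℤP.+-identityʳ (ℤ.+ negatives f c))
                                (ℤP.+-monoʳ-< (ℤ.+ negatives f c) neg))

    nonnegative⇒ : ∀ f c → ¬ (totalWeight f α c ℤ.< ℤ.0ℤ) → negatives f c ≤ positives f c
    nonnegative⇒ f c ¬neg =
      ℤP.drop‿+≤+ (subst₂ ℤ._≤_ (ℤP.+-identityʳ (ℤ.+ negatives f c)) (weight-split f c)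
                                (ℤP.+-monoʳ-≤ (ℤ.+ negatives f c) (ℤP.≮⇒≥ ¬neg)))

    improve : (f : Flow) → IsMaxFlow f → HasNegativeCycle f α →
              Σ Flow λ f* → IsMaxFlow f* × dist f* α < dist f α
    improve f f-max ([]     , () , _)
    improve f f-max (a ∷ as , (residual , linked , closed , simple) , negative) =
      augment , (λ g → subst (value g ≤_) (sym value-augment) (f-max g)) , fewer
      where
      C : Cycle (InResidual f)
      C = record { first = a ; rest = as ; all-S = residual ; linked = linked ; closed = closed ; simple = simple }
      open Augmentation (cycleAugmentation C)
      crossing : ∀ p n → Crossing (flow f (xn p n)) (augmented (xn p n)) (flow f (xn p n))
                                  (uses (a ∷ as) (xn p n))
      crossing p n = augment-crossing (bounded f (xn p n)) (raise≤1 (xn p n)) (lower≤1 (xn p n))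
                                      (raise-residual (xn p n)) (lower-residual (xn p n))
      fewer : dist augment α < dist f α
      fewer = +≡+⇒< (mismatches-crossing (flow f) augmented (flow f) (uses (a ∷ as)) crossing)
                    (subst₂ _<_ (ΣList-onXn (a ∷ as) _) (ΣList-onXn (a ∷ as) _)
                                (negative⇒ f (a ∷ as) negative))

    supported-start : (f g : Flow) → dist g α < dist f α → ∃ (Supported f g)
    supported-start f g closer
      with Σ-<⇒∃< (fin P ⊗ fin N) (λ (p , n) → ⟦ mismatch (flow g) p n ⟧)
                                  (λ (p , n) → ⟦ mismatch (flow f) p n ⟧) closer
    ... | (p , n) , fewer with <-cmp (flow f (xn p n)) (flow g (xn p n))
    ...   | tri< f<g _ _ = (xn p n , fwd) , f<g
    ...   | tri> _ _ g<f = (xn p n , bwd) , g<f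
    ...   | tri≈ _ f≡g _ = contradiction (cong (λ t → ⟦ one? t xor α p n ⟧) (sym f≡g)) (<⇒≢ fewer)

    dist-cancellation : ∀ {f g} (C : Cycle (Supported f g)) →
                        ¬ (totalWeight f α (Cycle.arcs C) ℤ.< ℤ.0ℤ) →
                        dist (Augmentation.augment (cancellation C)) α ≤ dist g α
    dist-cancellation {f} {g} C nonnegative =
      +≡+⇒≤ (mismatches-crossing (flow g′) (flow g) (flow f) (uses arcs) crossing)
            (subst₂ _≤_ (ΣList-onXn arcs _) (ΣList-onXn arcs _) (nonnegative⇒ f arcs nonnegative))
      where
      open Cycle C
      g′ : Flow
      g′ = Augmentation.augment (cancellation C)
      crossing : ∀ p n → Crossing (flow g′ (xn p n)) (flow g (xn p n)) (flow f (xn p n)) (uses arcs (xn p n))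
      crossing p n = cancel-crossing (bounded g (xn p n)) (bounded f (xn p n))
                                     (counted≤1 (xn p n , fwd)) (counted≤1 (xn p n , bwd))
                                     (counted⇒S (xn p n , fwd)) (counted⇒S (xn p n , bwd))

    negativeCycle : (f g : Flow) → value f ≡ value g → dist g α < dist f α → HasNegativeCycle f α
    negativeCycle f g = go g (On.wellFounded (gap f) <-wellFounded g)
      where
      go : ∀ g → Acc (_<_ on gap f) g → value f ≡ value g → dist g α < dist f α → HasNegativeCycle f α
      go g (acc smaller) same closer =
        attempt (findCycle (Supported f g) (supported-predecessor f g same) (proj₂ (supported-start f g closer)))
        where
        attempt : Cycle (Supported f g) → HasNegativeCycle f α
        attempt C with totalWeight f α (Cycle.arcs C) ℤP.<? ℤ.0ℤ
        ... | yes negative    = Cycle.arcs C , residual-cycle C , negative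
        ... | no  nonnegative =
          go (Augmentation.augment (cancellation C)) (smaller (gap-cancellation C))
             (trans same (sym (Augmentation.value-augment (cancellation C))))
             (≤-<-trans (dist-cancellation C nonnegative) closer)

proposition3 : (P N Z : ℕ) (zone : Fin N → Fin Z) (cap : Fin N → ℕ) (ρZ ρN s : ℕ) .{{_ : NonZero s}}
    → 1 ≤ ρZ → ρZ ≤ ρN
    → let open Network P N Z zone cap ρZ ρN s in
      (α' : Assignment) (f : Flow) → IsMaxFlow f
    → HasNegativeCycle f α' ⇔ Σ Flow (λ f* → IsMaxFlow f* × dist f* α' < dist f α')
proposition3 P N Z zone cap ρZ ρN s _ _ α f f-max =
  mk⇔ (improve f f-max)
      (λ (f* , f*-max , closer) → negativeCycle f f* (≤-antisym (f*-max f) (f-max f*)) closer)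
  where
  open Residual P N Z zone cap ρZ ρN s using (module Weights)
  open Weights α
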